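{- For every $n\geq 5$, the wheel $W_n$ has both an interval total $(n+1)$-coloring and an interval total $(n+2)$-coloring, i.e. $W_n\in\mathfrak{T}_{n+1}\cap\mathfrak{T}_{n+2}$.
   Context: All graphs are finite, undirected, without loops or multiple edges. For $n\geq 4$ the wheel $W_n$ has vertex set $\{u,v_1,\ldots,v_{n-1}\}$ and edge set $\{uv_i:1\leq i\leq n-1\}\cup\{v_iv_{i+1}:1\leq i\leq n-2\}\cup\{v_1v_{n-1}\}$. A total coloring of a graph $G$ is an assignment of colors to the vertices and edges of $G$ such that no two adjacent vertices, no two adjacent edges, and no vertex and an edge incident to it receive the same color. For a positive integer $t$, an interval total $t$-coloring of $G$ is a total coloring of $G$ with colors $1,2,\ldots,t$ such that each color $i\in\{1,\ldots,t\}$ is used on at least one vertex or edge, and for each vertex $v$ the set consisting of the color of $v$ and the colors of the edges incident to $v$ consists of $d_G(v)+1$ consecutive integers, where $d_G(v)$ is the degree of $v$. $\mathfrak{T}_t$ is the set of graphs having an interval total $t$-coloring. -}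

module Defs where

open import Data.Nat using (ℕ; zero; suc; _+_; _∸_; _≤_; _≡ᵇ_)
open import Data.Bool using (Bool; true; false; _∧_; _∨_; not; if_then_else_)
open import Data.Fin using (Fin; toℕ)
open import Data.List using (List; map; allFin)
open import Data.Nat.ListAction using (sum)
open import Data.Product using (Σ; _×_; _,_)
open import Data.Sum using (_⊎_)
open import Relation.Binary.PropositionalEquality using (_≡_; _≢_)
open import Function.Bundles using (_⇔_)

-- A (simple) graph on the vertex set Fin n given by a Boolean adjacency
-- relation (intended symmetric and irreflexive).
Adj : ℕ → Set
Adj n = Fin n → Fin n → Bool

degree : {n : ℕ} → Adj n → Fin n → ℕ
degree {n} adj v = sum (map (λ w → if adj v w then 1 else 0) (allFin n))

-- The wheel W_n on vertex set Fin n: vertex 0 is the hub u,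
-- vertex k (1 ≤ k ≤ n-1) is the rim vertex v_k.
wheelAdj : (n : ℕ) → Adj n
wheelAdj n i j =
  let a = toℕ i ; b = toℕ j in
  ((a ≡ᵇ 0) ∧ not (b ≡ᵇ 0)) ∨ ((b ≡ᵇ 0) ∧ not (a ≡ᵇ 0)) ∨
  (not (a ≡ᵇ 0) ∧ not (b ≡ᵇ 0) ∧
    ((suc a ≡ᵇ b) ∨ (suc b ≡ᵇ a) ∨ ((a ≡ᵇ 1) ∧ (b ≡ᵇ n ∸ 1)) ∨ ((b ≡ᵇ 1) ∧ (a ≡ᵇ n ∸ 1))))

-- A total colouring is given by a vertex colouring f and an edge colouring c,
-- where the colour of edge vw is c v w (required symmetric on edges).
record IntervalTotalColoring {n : ℕ} (adj : Adj n) (t : ℕ) : Set where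
  field
    f : Fin n → ℕ
    c : Fin n → Fin n → ℕ
    c-sym : ∀ v w → adj v w ≡ true → c v w ≡ c w v
    f-range : ∀ v → 1 ≤ f v × f v ≤ t
    c-range : ∀ v w → adj v w ≡ true → 1 ≤ c v w × c v w ≤ t
    vertex-proper : ∀ v w → adj v w ≡ true → f v ≢ f w
    edge-proper : ∀ v w w' → adj v w ≡ true → adj v w' ≡ true → w ≢ w' → c v w ≢ c v w'
    incidence-proper : ∀ v w → adj v w ≡ true → c v w ≢ f v
    all-used : ∀ k → 1 ≤ k → k ≤ t →
      (Σ (Fin n) λ v → f v ≡ k) ⊎ (Σ (Fin n) λ v → Σ (Fin n) λ w → adj v w ≡ true × c v w ≡ k)
    interval : ∀ v → Σ ℕ λ a → ∀ k →
      ((f v ≡ k) ⊎ (Σ (Fin n) λ w → adj v w ≡ true × c v w ≡ k)) ⇔ (a ≤ k × k ≤ a + degree adj v)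

InT : {n : ℕ} → Adj n → ℕ → Set
InT adj t = IntervalTotalColoring adj t

module Submission where

-- Write n = m + 1, with hub u and rim v₁ … vₘ.  The hub gets colour 1 and its spokes the
-- colours 2, …, m + 1, placed around the rim in the zigzag order 2, 4, 6, …, 7, 5, 3: up
-- through the even numbers and back down through the odd ones.  Adjacent rim vertices then
-- carry spoke colours x and x + 2, except across the two turning edges {2, 3} and
-- {m, m + 1}; a rim edge gets the number between its two spoke colours, and 1 or m + 2 on
-- the turning edges.  With the vertex colour x + 2 (2 for x = 3, m + 1 for x = m) the four
-- colours at a rim vertex with spoke colour x are consecutive.  The vertex with spoke colour
-- m + 1 sees m, m + 1 and m + 2 and may complete them by m − 1 or by m + 3; this choice
-- gives the interval total (m + 2)- and (m + 3)-colourings.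

open import Defs
open import Data.Nat.Properties
open import Algebra.Properties.CommutativeSemigroup +-commutativeSemigroup using (interchange)
open import Data.Bool using (true; false; if_then_else_; T; _∨_; _∧_)
open import Data.Bool.Properties using (T-≡; T-∨; T-∧)
open import Data.Empty using (⊥; ⊥-elim)
open import Data.Fin using (Fin; toℕ; fromℕ<) renaming (zero to fzero; suc to fsuc)
open import Data.Fin.Properties using (toℕ<n; toℕ-injective; toℕ-fromℕ<)
open import Data.List using (List; []; _∷_; map; upTo; allFin; length)
open import Data.List.Membership.Propositional using (_∈_)
open import Data.List.Membership.Propositional.Properties using (∈-map⁺; ∈-map⁻; ∈-upTo⁺; ∈-upTo⁻)
open import Data.List.Properties using (map-tabulate; map-cong; length-tabulate)
open import Data.List.Relation.Binary.Permutation.Propositional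
  using (_↭_; ↭-refl; ↭-sym; ↭-trans; ↭-reflexive; ↭-prep; ↭-swap; ↭⇒↭ₛ)
open import Data.List.Relation.Binary.Permutation.Propositional.Properties using (∈-resp-↭; map⁺)
import Data.List.Relation.Binary.Permutation.Setoid.Properties as Permutationₛ
open import Data.List.Relation.Unary.All using ([]; _∷_)
open import Data.List.Relation.Unary.AllPairs using ([]; _∷_)
open import Data.List.Relation.Unary.Any using (here; there)
open import Data.List.Relation.Unary.Unique.Propositional using (Unique)
import Data.List.Relation.Unary.Unique.Propositional.Properties as Unique
open import Data.List.Sort.InsertionSort.Base ≤-decTotalOrder using (sort)
open import Data.List.Sort.InsertionSort.Properties ≤-decTotalOrder using (sort-↭)
open import Data.Nat using (ℕ; zero; suc; pred; NonZero; >-nonZero; _+_; _*_; _∸_; _⊓_; _⊔_; _≤_; _<_; _≡ᵇ_; _≤ᵇ_; s≤s; z≤n)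
open import Data.Nat.ListAction using (sum)
open import Data.Product using (∃; Σ-syntax; _×_; _,_; proj₁; proj₂)
open import Data.Sum using (_⊎_; inj₁; inj₂; swap)
open import Function using (_∘_)
open import Function.Bundles using (_⇔_; mk⇔; Equivalence)
open import Relation.Binary.PropositionalEquality
open import Relation.Nullary using (yes; no; ¬_)

if-T : ∀ {A : Set} {b} {x y : A} → T b → (if b then x else y) ≡ x
if-T {b = true} _ = refl

if-¬T : ∀ {A : Set} {b} {x y : A} → ¬ T b → (if b then x else y) ≡ y
if-¬T {b = false} _ = refl
if-¬T {b = true} ¬t = ⊥-elim (¬t _)

if-≡ᵇ-yes : ∀ {A : Set} {a b} {x y : A} → a ≡ b → (if a ≡ᵇ b then x else y) ≡ x
if-≡ᵇ-yes {a = a} {b} a≡b = if-T (≡⇒≡ᵇ a b a≡b)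

if-≡ᵇ-no : ∀ {A : Set} {a b} {x y : A} → a ≢ b → (if a ≡ᵇ b then x else y) ≡ y
if-≡ᵇ-no {a = a} {b} a≢b = if-¬T (a≢b ∘ ≡ᵇ⇒≡ a b)

n≢1+n : ∀ n → n ≢ suc n
n≢1+n n = 1+n≢n ∘ sym

n≢2+n : ∀ n → n ≢ 2 + n
n≢2+n n = <⇒≢ (≤-trans (n<1+n n) (n≤1+n _))

2*n≡n+n : ∀ n → 2 * n ≡ n + n
2*n≡n+n n = cong (n +_) (+-identityʳ n)

2*a≤1+2*b⇒a≤b : ∀ {a b} → 2 * a ≤ suc (2 * b) → a ≤ b
2*a≤1+2*b⇒a≤b {a} {b} 2a≤1+2b =
  ≮⇒≥ λ b<a → 1+n≰n (≤-trans (≤-trans (≤-reflexive (sym (*-suc 2 b))) (*-monoʳ-≤ 2 b<a)) 2a≤1+2b)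

even-or-odd : ∀ x → ∃ λ y → x ≡ 2 * y ⊎ x ≡ suc (2 * y)
even-or-odd zero = 0 , inj₁ refl
even-or-odd (suc x) with even-or-odd x
... | y , inj₁ x≡2y = y , inj₂ (cong suc x≡2y)
... | y , inj₂ x≡1+2y = suc y , inj₁ (trans (cong suc x≡1+2y) (sym (*-suc 2 y)))

halves : ∀ m → Σ[ K ∈ ℕ ] Σ[ D ∈ ℕ ] m ≡ K + D × D ≤ K × K ≤ suc D
halves zero = 0 , 0 , refl , z≤n , z≤n
halves (suc m) with K , D , m≡K+D , D≤K , K≤1+D ← halves m with m≤n⇒m<n∨m≡n K≤1+D
... | inj₁ (s≤s K≤D) = suc K , D , cong suc m≡K+D , m≤n⇒m≤1+n D≤K , s≤s K≤D
... | inj₂ refl = suc D , suc D , trans (cong suc m≡K+D) (sym (+-suc (suc D) D)) , ≤-refl , n≤1+n _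

block : ℕ → ℕ → List ℕ
block α d = map (_+ α) (upTo (suc d))

∈-block⇔ : ∀ {α d k} → k ∈ block α d ⇔ (α ≤ k × k ≤ d + α)
∈-block⇔ {α} {d} {k} = mk⇔ to from
  where
  to : k ∈ block α d → α ≤ k × k ≤ d + α
  to k∈ with i , i∈ , refl ← ∈-map⁻ (_+ α) k∈ = m≤n+m α i , +-monoˡ-≤ α (≤-pred (∈-upTo⁻ i∈))
  from : α ≤ k × k ≤ d + α → k ∈ block α d
  from (α≤k , k≤d+α) = subst (_∈ block α d) (m∸n+n≡m α≤k)
    (∈-map⁺ (_+ α) (∈-upTo⁺ (s≤s (subst (k ∸ α ≤_) (m+n∸n≡m d α) (∸-monoˡ-≤ α k≤d+α)))))

unique-block : ∀ α d → Unique (block α d)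
unique-block α d = Unique.map⁺ (+-cancelʳ-≡ _ _ _) (Unique.upTo⁺ (suc d))

module _ {cs : List ℕ} {α d : ℕ} (cs↭ : cs ↭ block α d) where

  ↭-block-∈⇔ : ∀ {k} → k ∈ cs ⇔ (α ≤ k × k ≤ d + α)
  ↭-block-∈⇔ = mk⇔ (Equivalence.to ∈-block⇔ ∘ ∈-resp-↭ cs↭) (∈-resp-↭ (↭-sym cs↭) ∘ Equivalence.from ∈-block⇔)

  ↭-block-unique : Unique cs
  ↭-block-unique = Permutationₛ.Unique-resp-↭ (setoid ℕ) (↭⇒↭ₛ (↭-sym cs↭)) (unique-block α d)

offsets↭block : ∀ α d₀ d₁ d₂ d₃ {c₀ c₁ c₂ c₃} → sort (d₀ ∷ d₁ ∷ d₂ ∷ d₃ ∷ []) ≡ upTo 4 →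
  c₀ ≡ d₀ + α → c₁ ≡ d₁ + α → c₂ ≡ d₂ + α → c₃ ≡ d₃ + α → c₀ ∷ c₁ ∷ c₂ ∷ c₃ ∷ [] ↭ block α 3
offsets↭block α _ _ _ _ sorted refl refl refl refl = map⁺ (_+ α) (↭-trans (↭-sym (sort-↭ _)) (↭-reflexive sorted))

sum-map-+ : ∀ {A : Set} (g h : A → ℕ) xs → sum (map (λ x → g x + h x) xs) ≡ sum (map g xs) + sum (map h xs)
sum-map-+ g h [] = refl
sum-map-+ g h (x ∷ xs) = trans (cong (g x + h x +_) (sum-map-+ g h xs)) (interchange (g x) (h x) _ _)

sum-map-1 : ∀ {A : Set} (xs : List A) → sum (map (λ _ → 1) xs) ≡ length xs
sum-map-1 [] = refl
sum-map-1 (x ∷ xs) = cong suc (sum-map-1 xs)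

sum-allFin-suc : ∀ {n} (G : Fin (suc n) → ℕ) → sum (map G (allFin (suc n))) ≡ G fzero + sum (map (G ∘ fsuc) (allFin n))
sum-allFin-suc G = cong (λ xs → G fzero + sum xs) (trans (map-tabulate fsuc G) (sym (map-tabulate (λ i → i) (G ∘ fsuc))))

sum-allFin-0 : ∀ n → sum (map (λ (_ : Fin n) → 0) (allFin n)) ≡ 0
sum-allFin-0 zero = refl
sum-allFin-0 (suc n) = trans (sum-allFin-suc {n} (λ _ → 0)) (sum-allFin-0 n)

δ : ℕ → ℕ → ℕ
δ p b = if b ≡ᵇ p then 1 else 0

sum-δ : ∀ {n} p → p < n → sum (map (δ p ∘ toℕ) (allFin n)) ≡ 1
sum-δ {suc n} zero _ = trans (sum-allFin-suc {n} (δ 0 ∘ toℕ)) (cong suc (sum-allFin-0 n))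
sum-δ {suc n} (suc p) (s≤s p<n) = trans (sum-allFin-suc {n} (δ (suc p) ∘ toℕ)) (sum-δ p p<n)

module _ {n : ℕ} (adj : Adj n) (f : Fin n → ℕ) (c : Fin n → Fin n → ℕ) where

  ColourAt : Fin n → ℕ → Set
  ColourAt v k = (f v ≡ k) ⊎ (Σ[ w ∈ Fin n ] adj v w ≡ true × c v w ≡ k)

  fromLocalIntervals : ∀ {t} (start : Fin n → ℕ) →
    (∀ v w → adj v w ≡ true → c v w ≡ c w v) →
    (∀ v w → adj v w ≡ true → f v ≢ f w) →
    (∀ v w w′ → adj v w ≡ true → adj v w′ ≡ true → w ≢ w′ → c v w ≢ c v w′) →
    (∀ v w → adj v w ≡ true → c v w ≢ f v) →
    (∀ v k → ColourAt v k ⇔ (start v ≤ k × k ≤ start v + degree adj v)) →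
    (∀ v → 1 ≤ start v) → (∀ v → start v + degree adj v ≤ t) →
    (∀ k → 1 ≤ k → k ≤ t → ∃ λ v → ColourAt v k) →
    IntervalTotalColoring adj t
  fromLocalIntervals {t} start c-sym vertex-proper edge-proper incidence-proper interval 1≤start end≤t covered =
    record
      { f = f ; c = c ; c-sym = c-sym
      ; f-range = λ v → in-range v (inj₁ refl)
      ; c-range = λ v w vw → in-range v (inj₂ (w , vw , refl))
      ; vertex-proper = vertex-proper ; edge-proper = edge-proper ; incidence-proper = incidence-proper
      ; all-used = used
      ; interval = λ v → start v , interval v }
    where
    in-range : ∀ v {k} → ColourAt v k → 1 ≤ k × k ≤ t
    in-range v k∈ with start≤k , k≤end ← Equivalence.to (interval v _) k∈ =
      ≤-trans (1≤start v) start≤k , ≤-trans k≤end (end≤t v)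
    used : ∀ k → 1 ≤ k → k ≤ t →
      (Σ[ v ∈ Fin n ] f v ≡ k) ⊎ (Σ[ v ∈ Fin n ] Σ[ w ∈ Fin n ] adj v w ≡ true × c v w ≡ k)
    used k 1≤k k≤t with covered k 1≤k k≤t
    ... | v , inj₁ fv≡k = inj₁ (v , fv≡k)
    ... | v , inj₂ (w , vw , cvw≡k) = inj₂ (v , w , vw , cvw≡k)

module Rim (m : ℕ) (3≤m : 3 ≤ m) where

  prev : ℕ → ℕ
  prev zero = zero
  prev (suc zero) = m
  prev (suc (suc a)) = suc a

  next : ℕ → ℕ
  next a = if a ≡ᵇ m then 1 else suc a

  next-< : ∀ {a} → a < m → next a ≡ suc a
  next-< a<m = if-≡ᵇ-no (<⇒≢ a<m)

  next-m : next m ≡ 1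
  next-m = if-≡ᵇ-yes {a = m} refl

  prev-range : ∀ {a} → 1 ≤ a → a ≤ m → 1 ≤ prev a × prev a ≤ m
  prev-range {suc zero} _ _ = ≤-trans (s≤s z≤n) 3≤m , ≤-refl
  prev-range {suc (suc a)} _ a≤m = s≤s z≤n , ≤-trans (n≤1+n _) a≤m

  next-range : ∀ {a} → 1 ≤ a → a ≤ m → 1 ≤ next a × next a ≤ m
  next-range {a} _ a≤m with m≤n⇒m<n∨m≡n a≤m
  ... | inj₁ a<m rewrite next-< a<m = s≤s z≤n , a<m
  ... | inj₂ refl rewrite next-m = s≤s z≤n , ≤-trans (s≤s z≤n) 3≤m

  next-prev : ∀ {a} → 1 ≤ a → a ≤ m → next (prev a) ≡ a
  next-prev {suc zero} _ _ = next-m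
  next-prev {suc (suc a)} _ a≤m = next-< a≤m

  prev≢next : ∀ {a} → 1 ≤ a → a ≤ m → prev a ≢ next a
  prev≢next {suc zero} _ _ m≡next1 = <⇒≢ 3≤m (sym (trans m≡next1 (next-< (≤-trans (s≤s (s≤s z≤n)) 3≤m))))
  prev≢next {suc (suc a)} _ a≤m a+1≡next with m≤n⇒m<n∨m≡n a≤m
  ... | inj₁ a+2<m = <⇒≢ (m<n⇒m<1+n (n<1+n a)) (suc-injective (trans a+1≡next (next-< a+2<m)))
  ... | inj₂ refl = <⇒≢ 3≤m (cong (2 +_) (sym (suc-injective (trans a+1≡next next-m))))

  module Neighbours (v : Fin m) where
    p q : ℕ
    p = prev (suc (toℕ v))
    q = next (suc (toℕ v))
    p-range : 1 ≤ p × p ≤ m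
    p-range = prev-range (s≤s z≤n) (toℕ<n v)
    q-range : 1 ≤ q × q ≤ m
    q-range = next-range (s≤s z≤n) (toℕ<n v)
    0≢p : 0 ≢ p
    0≢p = <⇒≢ (proj₁ p-range)
    0≢q : 0 ≢ q
    0≢q = <⇒≢ (proj₁ q-range)
    p≢q : p ≢ q
    p≢q = prev≢next (s≤s z≤n) (toℕ<n v)

  private
    -- The left disjunct is passed explicitly: T is not injective, so it cannot be inferred.
    inr : ∀ x {y} → T y → T (x ∨ y)
    inr _ t = Equivalence.from T-∨ (inj₂ t)

    inl : ∀ {x y} → T x → T (x ∨ y)
    inl t = Equivalence.from T-∨ (inj₁ t)

  rim-adjacent⇒ : ∀ (v : Fin m) w → let a = suc (toℕ v) in
    wheelAdj (suc m) (fsuc v) w ≡ true → toℕ w ≡ 0 ⊎ toℕ w ≡ prev a ⊎ toℕ w ≡ next a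
  rim-adjacent⇒ v fzero _ = inj₁ refl
  rim-adjacent⇒ v (fsuc w) vw with Equivalence.to T-∨ (Equivalence.from T-≡ vw)
  ... | inj₁ a+2≡b+1 = inj₂ (inj₂ (trans (cong suc (sym a+1≡b)) (sym (next-< (subst (_< m) (sym a+1≡b) (toℕ<n w))))))
    where
    a+1≡b : suc (toℕ v) ≡ toℕ w
    a+1≡b = suc-injective (≡ᵇ⇒≡ (suc (suc (toℕ v))) (suc (toℕ w)) a+2≡b+1)
  ... | inj₂ vw′ with Equivalence.to T-∨ vw′
  ... | inj₁ b+2≡a+1 = inj₂ (inj₁ (sym (cong (prev ∘ suc) (suc-injective (sym (≡ᵇ⇒≡ (suc (suc (toℕ w))) (suc (toℕ v)) b+2≡a+1))))))
  ... | inj₂ vw″ with Equivalence.to T-∨ vw″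
  ... | inj₁ a-first with a+1≡1 , b+1≡m ← Equivalence.to T-∧ a-first =
    inj₂ (inj₁ (trans (≡ᵇ⇒≡ (suc (toℕ w)) m b+1≡m) (sym (cong prev (≡ᵇ⇒≡ (suc (toℕ v)) 1 a+1≡1)))))
  ... | inj₂ b-first with b+1≡1 , a+1≡m ← Equivalence.to T-∧ b-first =
    inj₂ (inj₂ (trans (≡ᵇ⇒≡ (suc (toℕ w)) 1 b+1≡1) (sym (trans (cong next (≡ᵇ⇒≡ (suc (toℕ v)) m a+1≡m)) next-m))))

  rim-adjacent⇐ : ∀ (v : Fin m) w → let a = suc (toℕ v) in
    toℕ w ≡ 0 ⊎ toℕ w ≡ prev a ⊎ toℕ w ≡ next a → wheelAdj (suc m) (fsuc v) w ≡ true
  rim-adjacent⇐ v fzero _ = refl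
  rim-adjacent⇐ v (fsuc w) (inj₁ ())
  rim-adjacent⇐ fzero (fsuc w) (inj₂ (inj₁ b+1≡m)) =
    Equivalence.to T-≡ (inr (2 ≡ᵇ suc (toℕ w)) (inr (suc (suc (toℕ w)) ≡ᵇ 1) (inl (≡⇒≡ᵇ (suc (toℕ w)) m b+1≡m))))
  rim-adjacent⇐ (fsuc v) (fsuc w) (inj₂ (inj₁ b≡a)) =
    Equivalence.to T-≡ (inr (suc (suc (suc (toℕ v))) ≡ᵇ suc (toℕ w)) (inl (≡⇒≡ᵇ (suc (suc (toℕ w))) (suc (suc (toℕ v))) (cong suc b≡a))))
  rim-adjacent⇐ v (fsuc w) (inj₂ (inj₂ b≡next)) with m≤n⇒m<n∨m≡n (toℕ<n v)
  ... | inj₁ a+1<m = Equivalence.to T-≡ (inl (≡⇒≡ᵇ (suc (suc a)) (suc b) (sym (trans b≡next (next-< a+1<m)))))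
    where
    a b : ℕ
    a = toℕ v
    b = toℕ w
  ... | inj₂ a+1≡m = Equivalence.to T-≡ (inr (suc (suc a) ≡ᵇ suc b) (inr (suc (suc b) ≡ᵇ suc a) (inr ((suc a ≡ᵇ 1) ∧ (suc b ≡ᵇ m))
        (Equivalence.from T-∧ (≡⇒≡ᵇ (suc b) 1 (trans b≡next (trans (cong next a+1≡m) next-m)) , ≡⇒≡ᵇ (suc a) m a+1≡m)))))
    where
    a b : ℕ
    a = toℕ v
    b = toℕ w

  rim-indicator : ∀ (v : Fin m) w → let a = suc (toℕ v) in
    (if wheelAdj (suc m) (fsuc v) w then 1 else 0) ≡ δ 0 (toℕ w) + δ (prev a) (toℕ w) + δ (next a) (toℕ w)
  rim-indicator v w with wheelAdj (suc m) (fsuc v) w in vw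
  ... | true with rim-adjacent⇒ v w vw
  ... | inj₁ b≡0 = sym (cong₂ _+_ (cong₂ _+_ (if-≡ᵇ-yes b≡0) (if-≡ᵇ-no λ b≡p → 0≢p (trans (sym b≡0) b≡p)))
                                  (if-≡ᵇ-no λ b≡q → 0≢q (trans (sym b≡0) b≡q)))
    where open Neighbours v
  ... | inj₂ (inj₁ b≡p) = sym (cong₂ _+_ (cong₂ _+_ (if-≡ᵇ-no λ b≡0 → 0≢p (trans (sym b≡0) b≡p)) (if-≡ᵇ-yes b≡p))
                                         (if-≡ᵇ-no λ b≡q → p≢q (trans (sym b≡p) b≡q)))
    where open Neighbours v
  ... | inj₂ (inj₂ b≡q) = sym (cong₂ _+_ (cong₂ _+_ (if-≡ᵇ-no λ b≡0 → 0≢q (trans (sym b≡0) b≡q))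
                                                    (if-≡ᵇ-no λ b≡p → p≢q (trans (sym b≡p) b≡q))) (if-≡ᵇ-yes b≡q))
    where open Neighbours v
  rim-indicator v w | false = sym (cong₂ _+_ (cong₂ _+_ (if-≡ᵇ-no λ b≡0 → nonadjacent (inj₁ b≡0))
                                                        (if-≡ᵇ-no λ b≡p → nonadjacent (inj₂ (inj₁ b≡p))))
                                             (if-≡ᵇ-no λ b≡q → nonadjacent (inj₂ (inj₂ b≡q))))
    where
    nonadjacent : ¬ (toℕ w ≡ 0 ⊎ toℕ w ≡ prev (suc (toℕ v)) ⊎ toℕ w ≡ next (suc (toℕ v)))
    nonadjacent nb with () ← trans (sym vw) (rim-adjacent⇐ v w nb)

  degree-hub : degree (wheelAdj (suc m)) fzero ≡ m
  degree-hub = trans (sum-allFin-suc {m} (λ w → if wheelAdj (suc m) fzero w then 1 else 0))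
                     (trans (sum-map-1 (allFin m)) (length-tabulate (λ i → i)))

  degree-rim : ∀ (v : Fin m) → degree (wheelAdj (suc m)) (fsuc v) ≡ 3
  degree-rim v = begin
    total (λ w → if wheelAdj (suc m) (fsuc v) w then 1 else 0)
      ≡⟨ cong sum (map-cong (rim-indicator v) (allFin (suc m))) ⟩
    total (λ w → δ 0 (toℕ w) + δ p (toℕ w) + δ q (toℕ w))
      ≡⟨ sum-map-+ (λ w → δ 0 (toℕ w) + δ p (toℕ w)) (δ q ∘ toℕ) (allFin (suc m)) ⟩
    total (λ w → δ 0 (toℕ w) + δ p (toℕ w)) + total (δ q ∘ toℕ)
      ≡⟨ cong (_+ total (δ q ∘ toℕ)) (sum-map-+ (δ 0 ∘ toℕ) (δ p ∘ toℕ) (allFin (suc m))) ⟩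
    total (δ 0 ∘ toℕ) + total (δ p ∘ toℕ) + total (δ q ∘ toℕ)
      ≡⟨ cong₂ _+_ (cong₂ _+_ (sum-δ {suc m} 0 (s≤s z≤n)) (sum-δ p (s≤s (proj₂ p-range)))) (sum-δ q (s≤s (proj₂ q-range))) ⟩
    3 ∎
    where
    open ≡-Reasoning
    open Neighbours v
    total : (Fin (suc m) → ℕ) → ℕ
    total G = sum (map G (allFin (suc m)))

-- The colour s of the rim vertex with spoke colour m + 1, and the resulting number t of colours.
data ApexColour (m : ℕ) : ℕ → ℕ → Set where
  below : ApexColour m (pred m) (2 + m)
  above : ApexColour m (3 + m) (3 + m)

module Zigzag (μ : ℕ) where

  -- Taking m = 4 + μ makes the comparisons of m with 2 and 3 compute.
  m : ℕ
  m = 4 + μ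

  lo : ℕ → ℕ
  lo 2 = 3
  lo 3 = 2
  lo x = x ∸ 2

  hi : ℕ → ℕ
  hi x = if x ≡ᵇ m then suc m else if x ≡ᵇ suc m then m else suc (suc x)

  edgeCol : ℕ → ℕ → ℕ
  edgeCol x y = if suc (x ⊓ y) ≡ᵇ x ⊔ y then (if x ⊓ y ≡ᵇ 2 then 1 else suc (suc m)) else suc (x ⊓ y)

  lo-step : ∀ {y} → 2 ≤ y → lo (suc (suc y)) ≡ y
  lo-step (s≤s (s≤s _)) = refl

  hi-step : ∀ {x} → x < m → hi x ≡ suc (suc x)
  hi-step x<m = trans (if-≡ᵇ-no (<⇒≢ x<m)) (if-≡ᵇ-no (<⇒≢ (m<n⇒m<1+n x<m)))

  hi-m : hi m ≡ suc m
  hi-m = if-≡ᵇ-yes {a = m} refl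

  hi-apex : hi (suc m) ≡ m
  hi-apex = trans (if-≡ᵇ-no {a = suc m} 1+n≢n) (if-≡ᵇ-yes {a = suc m} refl)

  edgeCol-sym : ∀ x y → edgeCol x y ≡ edgeCol y x
  edgeCol-sym x y rewrite ⊓-comm x y | ⊔-comm x y = refl

  edgeCol-step : ∀ x → edgeCol x (suc (suc x)) ≡ suc x
  edgeCol-step x rewrite m≤n⇒m⊓n≡m (m≤n+m x 2) | m≤n⇒m⊔n≡n (m≤n+m x 2) = if-≡ᵇ-no {a = suc x} (n≢1+n (suc x))

  edgeCol-top : edgeCol m (suc m) ≡ suc (suc m)
  edgeCol-top rewrite m≤n⇒m⊓n≡m (n≤1+n μ) | m≤n⇒m⊔n≡n (n≤1+n μ) = if-≡ᵇ-yes {a = suc m} refl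

  edgeCol-apex-lo : edgeCol (suc m) (lo (suc m)) ≡ m
  edgeCol-apex-lo = trans (edgeCol-sym (suc m) (3 + μ)) (edgeCol-step (3 + μ))

  edgeCol-apex-hi : edgeCol (suc m) (hi (suc m)) ≡ 2 + m
  edgeCol-apex-hi = trans (cong (edgeCol (suc m)) hi-apex) (trans (edgeCol-sym (suc m) m) edgeCol-top)

  data Zig : ℕ → ℕ → Set where
    step   : ∀ {x} → 2 ≤ x → x < m → Zig x (2 + x)
    bottom : Zig 2 3
    top    : Zig m (suc m)

  ZigAdjacent : ℕ → ℕ → Set
  ZigAdjacent x y = Zig x y ⊎ Zig y x

  zig-neighbour : ∀ {x y} → ZigAdjacent x y → y ≡ lo x ⊎ y ≡ hi x
  zig-neighbour (inj₁ (step _ x<m)) = inj₂ (sym (hi-step x<m))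
  zig-neighbour (inj₁ bottom) = inj₁ refl
  zig-neighbour (inj₁ top) = inj₂ (sym hi-m)
  zig-neighbour (inj₂ (step 2≤y _)) = inj₁ (sym (lo-step 2≤y))
  zig-neighbour (inj₂ bottom) = inj₁ refl
  zig-neighbour (inj₂ top) = inj₂ (sym hi-apex)

  data Level : ℕ → Set where
    bottom₂ : Level 2
    bottom₃ : Level 3
    middle  : ∀ {y} → 2 ≤ y → 3 + y ≤ m → Level (2 + y)
    peak    : Level m
    apex    : Level (suc m)

  level : ∀ {x} → 2 ≤ x → x ≤ suc m → Level x
  level {1} (s≤s ()) _
  level {2} _ _ = bottom₂
  level {3} _ _ = bottom₃
  level {suc (suc (suc (suc y)))} _ x≤1+m with m≤n⇒m<n∨m≡n x≤1+m
  ... | inj₂ refl = apex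
  ... | inj₁ (s≤s x≤m) with m≤n⇒m<n∨m≡n x≤m
  ... | inj₂ refl = peak
  ... | inj₁ x<m = middle (s≤s (s≤s z≤n)) x<m

  module Colouring {s t : ℕ} (apex-colour : ApexColour m s t) where

    vertexCol : ℕ → ℕ
    vertexCol x = if x ≡ᵇ 3 then 2 else if x ≡ᵇ m then suc m else if x ≡ᵇ suc m then s else suc (suc x)

    vertexCol-step : ∀ {x} → x ≢ 3 → x < m → vertexCol x ≡ suc (suc x)
    vertexCol-step x≢3 x<m = trans (if-≡ᵇ-no x≢3) (trans (if-≡ᵇ-no (<⇒≢ x<m)) (if-≡ᵇ-no (<⇒≢ (m<n⇒m<1+n x<m))))

    vertexCol-m : vertexCol m ≡ suc m
    vertexCol-m = if-≡ᵇ-yes {a = m} refl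

    vertexCol-apex : vertexCol (suc m) ≡ s
    vertexCol-apex = trans (if-≡ᵇ-no {a = suc m} 1+n≢n) (if-≡ᵇ-yes {a = suc m} refl)

    vertexCol-below-m : ∀ {x} → x < m → vertexCol x ≡ 2 ⊎ vertexCol x ≡ 2 + x
    vertexCol-below-m {x} x<m with x ≟ 3
    ... | yes refl = inj₁ refl
    ... | no x≢3 = inj₂ (vertexCol-step x≢3 x<m)

    apex-colour-fresh : 3 ≤ s × s ≢ suc m
    apex-colour-fresh = fresh apex-colour
      where
      fresh : ApexColour m s t → 3 ≤ s × s ≢ suc m
      fresh below = s≤s (s≤s (s≤s z≤n)) , n≢2+n (3 + μ)
      fresh above = s≤s (s≤s (s≤s z≤n)) , n≢2+n (5 + μ) ∘ sym

    2+m≤t : 2 + m ≤ t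
    2+m≤t = bound apex-colour
      where
      bound : ApexColour m s t → 2 + m ≤ t
      bound below = ≤-refl
      bound above = n≤1+n _

    2≤vertexCol : ∀ {x} → x ≤ suc m → 2 ≤ vertexCol x
    2≤vertexCol x≤1+m with m≤n⇒m<n∨m≡n x≤1+m
    ... | inj₂ refl = subst (2 ≤_) (sym vertexCol-apex) (≤-trans (n≤1+n 2) (proj₁ apex-colour-fresh))
    ... | inj₁ (s≤s x≤m) with m≤n⇒m<n∨m≡n x≤m
    ... | inj₂ refl = subst (2 ≤_) (sym vertexCol-m) (s≤s (s≤s z≤n))
    ... | inj₁ x<m with vertexCol-below-m x<m
    ... | inj₁ col≡2 = ≤-reflexive (sym col≡2)
    ... | inj₂ col≡2+x = subst (2 ≤_) (sym col≡2+x) (s≤s (s≤s z≤n))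

    vertexCol-step-differs : ∀ {x c} → x < m → vertexCol (2 + x) ≡ c → 2 ≢ c → 2 + x ≢ c → vertexCol x ≢ vertexCol (2 + x)
    vertexCol-step-differs x<m col≡c 2≢c 2+x≢c col≡col with vertexCol-below-m x<m
    ... | inj₁ col≡2 = 2≢c (trans (sym col≡2) (trans col≡col col≡c))
    ... | inj₂ col≡2+x = 2+x≢c (trans (sym col≡2+x) (trans col≡col col≡c))

    vertexCol-proper : ∀ {x y} → Zig x y → vertexCol x ≢ vertexCol y
    vertexCol-proper bottom = λ ()
    vertexCol-proper top col≡col = proj₂ apex-colour-fresh (trans (sym vertexCol-apex) (trans (sym col≡col) vertexCol-m))
    vertexCol-proper (step {x} _ x<m) with level {2 + x} (s≤s (s≤s z≤n)) (s≤s x<m)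
    vertexCol-proper (step () _) | bottom₂
    vertexCol-proper (step (s≤s ()) _) | bottom₃
    ... | middle (s≤s (s≤s _)) 3+x≤m = vertexCol-step-differs x<m (vertexCol-step (λ ()) 3+x≤m) (λ ()) (n≢2+n (2 + x))
    ... | peak = vertexCol-step-differs x<m vertexCol-m (λ ()) (n≢1+n m)
    ... | apex = vertexCol-step-differs x<m vertexCol-apex (<⇒≢ (proj₁ apex-colour-fresh)) (proj₂ apex-colour-fresh ∘ sym)

    colours : ℕ → List ℕ
    colours x = vertexCol x ∷ x ∷ edgeCol x (lo x) ∷ edgeCol x (hi x) ∷ []

    local-block : ∀ {x} → Level x → Σ[ α ∈ ℕ ] 1 ≤ α × 3 + α ≤ t × colours x ↭ block α 3
    local-block bottom₂ = 1 , ≤-refl , ≤-trans (m≤m+n 4 (2 + μ)) 2+m≤t ,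
      offsets↭block 1 3 1 0 2 refl (vertexCol-step (λ ()) 2<m) refl refl (trans (cong (edgeCol 2) (hi-step 2<m)) (edgeCol-step 2))
      where
      2<m : 2 < m
      2<m = m≤m+n 3 (1 + μ)
    local-block bottom₃ = 1 , ≤-refl , ≤-trans (m≤m+n 4 (2 + μ)) 2+m≤t ,
      offsets↭block 1 1 2 0 3 refl refl refl refl (trans (cong (edgeCol 3) (hi-step 3<m)) (edgeCol-step 3))
      where
      3<m : 3 < m
      3<m = m≤m+n 4 μ
    local-block (middle {y} 2≤y@(s≤s (s≤s _)) 3+y≤m) = suc y , s≤s z≤n , ≤-trans (s≤s 3+y≤m) (≤-trans (n≤1+n (suc m)) 2+m≤t) ,
      offsets↭block (suc y) 3 1 0 2 refl (vertexCol-step (λ ()) 3+y≤m) refl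
        (trans (cong (edgeCol (2 + y)) (lo-step 2≤y)) (trans (edgeCol-sym (2 + y) y) (edgeCol-step y)))
        (trans (cong (edgeCol (2 + y)) (hi-step 3+y≤m)) (edgeCol-step (2 + y)))
    local-block peak = 3 + μ , s≤s z≤n , 2+m≤t ,
      offsets↭block (3 + μ) 2 1 0 3 refl vertexCol-m refl (trans (edgeCol-sym m (2 + μ)) (edgeCol-step (2 + μ)))
        (trans (cong (edgeCol m) hi-m) edgeCol-top)
    local-block apex = apex-block apex-colour
      where
      apex-block : ApexColour m s t → Σ[ α ∈ ℕ ] 1 ≤ α × 3 + α ≤ t × colours (suc m) ↭ block α 3
      apex-block below = 3 + μ , s≤s z≤n , ≤-refl , offsets↭block (3 + μ) 0 2 1 3 refl vertexCol-apex refl edgeCol-apex-lo edgeCol-apex-hi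
      apex-block above = m , s≤s z≤n , ≤-refl , offsets↭block m 3 1 0 2 refl vertexCol-apex refl edgeCol-apex-lo edgeCol-apex-hi

    ∈-colours-apex : ∀ {k} → suc m < k → k ≤ t → k ∈ colours (suc m)
    ∈-colours-apex = reach apex-colour
      where
      reach : ApexColour m s t → ∀ {k} → suc m < k → k ≤ t → k ∈ colours (suc m)
      reach below 1+m<k k≤t with refl ← ≤-antisym k≤t 1+m<k = there (there (there (here (sym edgeCol-apex-hi))))
      reach above 1+m<k k≤t with m≤n⇒m<n∨m≡n k≤t
      ... | inj₂ refl = here (sym vertexCol-apex)
      ... | inj₁ (s≤s k≤2+m) with refl ← ≤-antisym k≤2+m 1+m<k = there (there (there (here (sym edgeCol-apex-hi))))

module Spokes (μ K D : ℕ) (m≡K+D : 4 + μ ≡ K + D) (D≤K : D ≤ K) (K≤1+D : K ≤ suc D) where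
  open Zigzag μ using (m; Zig; ZigAdjacent; step; bottom; top)
  open Rim m (≤-trans (n≤1+n 3) (m≤m+n 4 μ)) using (next; next-<; next-m)

  spoke : ℕ → ℕ
  spoke a = if a ≤ᵇ K then 2 * a else 3 + 2 * (m ∸ a)

  2K≤1+m : 2 * K ≤ suc m
  2K≤1+m = begin
    2 * K        ≡⟨ 2*n≡n+n K ⟩
    K + K        ≤⟨ +-monoʳ-≤ K K≤1+D ⟩
    K + suc D    ≡⟨ +-suc K D ⟩
    suc (K + D)  ≡⟨ cong suc (sym m≡K+D) ⟩
    suc m        ∎
    where open ≤-Reasoning

  m≤2K : m ≤ 2 * K
  m≤2K = begin
    m        ≡⟨ m≡K+D ⟩
    K + D    ≤⟨ +-monoʳ-≤ K D≤K ⟩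
    K + K    ≡⟨ 2*n≡n+n K ⟨
    2 * K    ∎
    where open ≤-Reasoning

  2D≤m : 2 * D ≤ m
  2D≤m = begin
    2 * D    ≡⟨ 2*n≡n+n D ⟩
    D + D    ≤⟨ +-monoˡ-≤ D D≤K ⟩
    K + D    ≡⟨ m≡K+D ⟨
    m        ∎
    where open ≤-Reasoning

  m≤1+2D : m ≤ suc (2 * D)
  m≤1+2D = begin
    m            ≡⟨ m≡K+D ⟩
    K + D        ≤⟨ +-monoˡ-≤ D K≤1+D ⟩
    suc (D + D)  ≡⟨ cong suc (2*n≡n+n D) ⟨
    suc (2 * D)  ∎
    where open ≤-Reasoning

  2≤D : 2 ≤ D
  2≤D = ≰⇒> λ D≤1 → <⇒≱ (m≤m+n 4 μ) (≤-trans m≤1+2D (s≤s (*-monoʳ-≤ 2 D≤1)))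

  1≤K : 1 ≤ K
  1≤K = ≤-trans (n≤1+n 1) (≤-trans 2≤D D≤K)

  D≤m : D ≤ m
  D≤m = subst (D ≤_) (sym m≡K+D) (m≤n+m D K)

  K<m : K < m
  K<m = subst (K <_) (sym m≡K+D) (subst (_≤ K + D) (+-comm K 1) (+-monoʳ-≤ K (≤-trans (n≤1+n 1) 2≤D)))

  spoke-ascending : ∀ {a} → a ≤ K → spoke a ≡ 2 * a
  spoke-ascending a≤K = if-T (≤⇒≤ᵇ a≤K)

  spoke-descending : ∀ {r} → r < D → spoke (m ∸ r) ≡ 3 + 2 * r
  spoke-descending {r} r<D = trans (if-¬T (<⇒≱ K<m∸r ∘ ≤ᵇ⇒≤ (m ∸ r) K)) (cong (λ z → 3 + 2 * z) (m∸[m∸n]≡n r≤m))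
    where
    K+r<m : K + r < m
    K+r<m = subst (K + r <_) (sym m≡K+D) (+-monoʳ-< K r<D)
    r≤m : r ≤ m
    r≤m = ≤-trans (m≤n+m r K) (<⇒≤ K+r<m)
    K<m∸r : K < m ∸ r
    K<m∸r = subst (_< m ∸ r) (m+n∸n≡m K r) (∸-monoˡ-< K+r<m (m≤n+m r K))

  data Side : ℕ → Set where
    ascending  : ∀ {a} → 1 ≤ a → a ≤ K → Side a
    descending : ∀ {r} → r < D → Side (m ∸ r)

  side : ∀ {a} → 1 ≤ a → a ≤ m → Side a
  side {a} 1≤a a≤m with a ≤? K
  ... | yes a≤K = ascending 1≤a a≤K
  ... | no a≰K = subst Side (m∸[m∸n]≡n a≤m) (descending m∸a<D)
    where
    m∸a<D : m ∸ a < D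
    m∸a<D = subst (m ∸ a <_) (trans (cong (_∸ K) m≡K+D) (m+n∸m≡n K D)) (∸-monoʳ-< (≰⇒> a≰K) a≤m)

  spoke-range : ∀ {a} → Side a → 2 ≤ spoke a × spoke a ≤ suc m
  spoke-range (ascending 1≤a a≤K) rewrite spoke-ascending a≤K = *-monoʳ-≤ 2 1≤a , ≤-trans (*-monoʳ-≤ 2 a≤K) 2K≤1+m
  spoke-range (descending {r} r<D) rewrite spoke-descending r<D =
    s≤s (s≤s z≤n) , s≤s (≤-trans (≤-reflexive (sym (*-suc 2 r))) (≤-trans (*-monoʳ-≤ 2 r<D) 2D≤m))

  spoke-descending-odd : ∀ {r} → r < D → spoke (m ∸ r) ≡ suc (2 * suc r)
  spoke-descending-odd {r} r<D = trans (spoke-descending r<D) (cong suc (sym (*-suc 2 r)))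

  spoke-injective : ∀ {a b} → Side a → Side b → spoke a ≡ spoke b → a ≡ b
  spoke-injective (ascending _ a≤K) (ascending _ b≤K) eq =
    *-cancelˡ-≡ _ _ 2 (trans (sym (spoke-ascending a≤K)) (trans eq (spoke-ascending b≤K)))
  spoke-injective (ascending {a} _ a≤K) (descending {r} r<D) eq =
    ⊥-elim (even≢odd a (suc r) (trans (sym (spoke-ascending a≤K)) (trans eq (spoke-descending-odd r<D))))
  spoke-injective (descending {r} r<D) (ascending {b} _ b≤K) eq =
    ⊥-elim (even≢odd b (suc r) (trans (sym (spoke-ascending b≤K)) (trans (sym eq) (spoke-descending-odd r<D))))
  spoke-injective (descending {r} r<D) (descending {r′} r′<D) eq =
    cong (m ∸_) (*-cancelˡ-≡ r r′ 2 (+-cancelˡ-≡ 3 _ _ (trans (sym (spoke-descending r<D)) (trans eq (spoke-descending r′<D)))))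

  spoke-surjective : ∀ {x} → 2 ≤ x → x ≤ suc m → ∃ λ a → 1 ≤ a × a ≤ m × spoke a ≡ x
  spoke-surjective {x} 2≤x x≤1+m with even-or-odd x
  ... | zero , inj₁ refl = ⊥-elim (<⇒≱ 2≤x z≤n)
  ... | suc y , inj₁ refl = suc y , s≤s z≤n , ≤-trans y≤K (<⇒≤ K<m) , spoke-ascending y≤K
    where
    y≤K : suc y ≤ K
    y≤K = 2*a≤1+2*b⇒a≤b (≤-trans x≤1+m (s≤s m≤2K))
  ... | zero , inj₂ refl = ⊥-elim (<⇒≱ 2≤x (s≤s z≤n))
  ... | suc r , inj₂ refl = m ∸ r , m<n⇒0<n∸m (<-≤-trans r<D D≤m) , m∸n≤m m r , spoke-descending-odd r<D
    where
    r<D : r < D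
    r<D = 2*a≤1+2*b⇒a≤b (≤-trans (≤-pred x≤1+m) m≤1+2D)

  spoke-1+K : spoke (suc K) ≡ suc (2 * D)
  spoke-1+K = begin
    spoke (suc K)                  ≡⟨ if-¬T (1+n≰n ∘ ≤ᵇ⇒≤ (suc K) K) ⟩
    3 + 2 * (m ∸ suc K)            ≡⟨ cong (λ z → 3 + 2 * z) (pred[m∸n]≡m∸[1+n] m K) ⟨
    3 + 2 * pred (m ∸ K)           ≡⟨ cong (λ z → 3 + 2 * pred z) (trans (cong (_∸ K) m≡K+D) (m+n∸m≡n K D)) ⟩
    3 + 2 * pred D                 ≡⟨ cong suc (*-suc 2 (pred D)) ⟨
    suc (2 * suc (pred D))         ≡⟨ cong (λ z → suc (2 * z)) (suc-pred D) ⟩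
    suc (2 * D)                    ∎
    where
    open ≡-Reasoning
    instance
      D≢0 : NonZero D
      D≢0 = >-nonZero (≤-trans (n≤1+n 1) 2≤D)

  spoke-turn : (spoke K ≡ m × spoke (suc K) ≡ suc m) ⊎ (spoke K ≡ suc m × spoke (suc K) ≡ m)
  spoke-turn with m≤n⇒m<n∨m≡n K≤1+D
  ... | inj₁ (s≤s K≤D) = inj₁ (trans (spoke-ascending ≤-refl) (trans (2*n≡n+n K) (trans (cong (K +_) K≡D) (sym m≡K+D))) ,
                               trans spoke-1+K (cong suc (trans (2*n≡n+n D) (trans (cong (_+ D) (sym K≡D)) (sym m≡K+D)))))
    where
    K≡D : K ≡ D
    K≡D = ≤-antisym K≤D D≤K
  ... | inj₂ K≡1+D = inj₂ (trans (spoke-ascending ≤-refl) (trans (2*n≡n+n K) (trans (cong (K +_) K≡1+D) (trans (+-suc K D) (cong suc (sym m≡K+D))))) ,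
                          trans spoke-1+K (trans (cong suc (2*n≡n+n D)) (trans (cong (_+ D) (sym K≡1+D)) (sym m≡K+D))))

  spoke-next : ∀ {a} → Side a → ZigAdjacent (spoke a) (spoke (next a))
  spoke-next (ascending {a} 1≤a a≤K) with m≤n⇒m<n∨m≡n a≤K
  ... | inj₁ a<K = subst₂ ZigAdjacent (sym (spoke-ascending a≤K)) (sym spoke[next]) (inj₁ (step (*-monoʳ-≤ 2 1≤a) 2a<m))
    where
    spoke[next] : spoke (next a) ≡ 2 + 2 * a
    spoke[next] = trans (cong spoke (next-< (<-trans a<K K<m))) (trans (spoke-ascending a<K) (*-suc 2 a))
    2a<m : 2 * a < m
    2a<m = ≤-pred (≤-trans (≤-reflexive (sym (*-suc 2 a))) (≤-trans (*-monoʳ-≤ 2 a<K) 2K≤1+m))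
  ... | inj₂ refl with spoke-turn
  ... | inj₁ (spoke[K]≡m , spoke[1+K]≡1+m) =
    subst₂ ZigAdjacent (sym spoke[K]≡m) (sym (trans (cong spoke (next-< K<m)) spoke[1+K]≡1+m)) (inj₁ top)
  ... | inj₂ (spoke[K]≡1+m , spoke[1+K]≡m) =
    subst₂ ZigAdjacent (sym spoke[K]≡1+m) (sym (trans (cong spoke (next-< K<m)) spoke[1+K]≡m)) (inj₂ top)
  spoke-next (descending {zero} 0<D) =
    subst₂ ZigAdjacent (sym (spoke-descending 0<D)) (sym (trans (cong spoke next-m) (spoke-ascending 1≤K))) (inj₂ bottom)
  spoke-next (descending {suc r} 1+r<D) = subst₂ ZigAdjacent (sym spoke[a]) (sym spoke[next]) (inj₂ (step (s≤s (s≤s z≤n)) 3+2r<m))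
    where
    1+r≤m : suc r ≤ m
    1+r≤m = ≤-trans (<⇒≤ 1+r<D) D≤m
    spoke[a] : spoke (m ∸ suc r) ≡ 2 + (3 + 2 * r)
    spoke[a] = trans (spoke-descending 1+r<D) (cong (3 +_) (*-suc 2 r))
    spoke[next] : spoke (next (m ∸ suc r)) ≡ 3 + 2 * r
    spoke[next] = trans (cong spoke (trans (next-< (∸-monoʳ-< (s≤s z≤n) 1+r≤m)) (sym (+-∸-assoc 1 1+r≤m))))
                        (spoke-descending (<-trans (n<1+n r) 1+r<D))
    3+2r<m : 3 + 2 * r < m
    3+2r<m = ≤-trans (≤-reflexive (sym (trans (*-suc 2 (suc r)) (cong (2 +_) (*-suc 2 r))))) (≤-trans (*-monoʳ-≤ 2 1+r<D) 2D≤m)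

module WheelColouring (μ K D : ℕ) (m≡K+D : 4 + μ ≡ K + D) (D≤K : D ≤ K) (K≤1+D : K ≤ suc D)
                      {s t : ℕ} (apex-colour : ApexColour (4 + μ) s t) where
  open Zigzag μ
  open Colouring apex-colour
  open Spokes μ K D m≡K+D D≤K K≤1+D
  open Rim m (≤-trans (n≤1+n 3) (m≤m+n 4 μ))

  vertexColour : ℕ → ℕ
  vertexColour zero = 1
  vertexColour (suc a) = vertexCol (spoke (suc a))

  edgeColour : ℕ → ℕ → ℕ
  edgeColour zero b = spoke b
  edgeColour (suc a) zero = spoke (suc a)
  edgeColour (suc a) (suc b) = edgeCol (spoke (suc a)) (spoke (suc b))

  edgeColour-sym : ∀ a b → edgeColour a b ≡ edgeColour b a
  edgeColour-sym zero zero = refl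
  edgeColour-sym zero (suc b) = refl
  edgeColour-sym (suc a) zero = refl
  edgeColour-sym (suc a) (suc b) = edgeCol-sym (spoke (suc a)) (spoke (suc b))

  adj : Adj (suc m)
  adj = wheelAdj (suc m)

  f : Fin (suc m) → ℕ
  f v = vertexColour (toℕ v)

  c : Fin (suc m) → Fin (suc m) → ℕ
  c v w = edgeColour (toℕ v) (toℕ w)

  Colour : Fin (suc m) → ℕ → Set
  Colour = ColourAt adj f c

  rim-side : ∀ (v : Fin m) → Side (suc (toℕ v))
  rim-side v = side (s≤s z≤n) (toℕ<n v)

  rim-vertex : ∀ {a} → 1 ≤ a → a ≤ m → Σ[ v ∈ Fin m ] suc (toℕ v) ≡ a
  rim-vertex {suc a} _ a<m = fromℕ< a<m , cong suc (toℕ-fromℕ< a<m)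

  hub-colour⇔ : ∀ k → Colour fzero k ⇔ (1 ≤ k × k ≤ suc m)
  hub-colour⇔ k = mk⇔ to (from k)
    where
    to : Colour fzero k → 1 ≤ k × k ≤ suc m
    to (inj₁ refl) = ≤-refl , s≤s z≤n
    to (inj₂ (fsuc w , _ , refl)) with 2≤x , x≤1+m ← spoke-range (rim-side w) = ≤-trans (n≤1+n 1) 2≤x , x≤1+m
    from : ∀ k → 1 ≤ k × k ≤ suc m → Colour fzero k
    from (suc zero) _ = inj₁ refl
    from (suc (suc k)) (_ , k≤1+m) with a , 1≤a , a≤m , spoke≡k ← spoke-surjective (s≤s (s≤s z≤n)) k≤1+m
      with v , refl ← rim-vertex 1≤a a≤m = inj₂ (fsuc v , refl , spoke≡k)

  vertexCol-adjacent : ∀ {y z} → ZigAdjacent y z → vertexCol y ≢ vertexCol z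
  vertexCol-adjacent (inj₁ yz) = vertexCol-proper yz
  vertexCol-adjacent (inj₂ zy) = vertexCol-proper zy ∘ sym

  module AtRim (v : Fin m) where
    open Neighbours v public

    x : ℕ
    x = spoke (suc (toℕ v))

    rimColours : List ℕ
    rimColours = vertexCol x ∷ x ∷ edgeCol x (spoke p) ∷ edgeCol x (spoke q) ∷ []

    Incident : Fin (suc m) → Set
    Incident w = (toℕ w ≡ 0 × c (fsuc v) w ≡ x)
               ⊎ (toℕ w ≡ p × c (fsuc v) w ≡ edgeCol x (spoke p))
               ⊎ (toℕ w ≡ q × c (fsuc v) w ≡ edgeCol x (spoke q))

    incident : ∀ w → adj (fsuc v) w ≡ true → Incident w
    incident fzero _ = inj₁ (refl , refl)
    incident (fsuc w) vw with rim-adjacent⇒ v (fsuc w) vw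
    ... | inj₂ (inj₁ b≡p) = inj₂ (inj₁ (b≡p , cong (edgeCol x ∘ spoke) b≡p))
    ... | inj₂ (inj₂ b≡q) = inj₂ (inj₂ (b≡q , cong (edgeCol x ∘ spoke) b≡q))

    zig-next : ZigAdjacent x (spoke q)
    zig-next = spoke-next (rim-side v)

    zig-prev : ZigAdjacent x (spoke p)
    zig-prev = swap (subst (ZigAdjacent (spoke p) ∘ spoke) (next-prev (s≤s z≤n) (toℕ<n v))
                           (spoke-next (side (proj₁ p-range) (proj₂ p-range))))

    spoke[p]≢spoke[q] : spoke p ≢ spoke q
    spoke[p]≢spoke[q] = p≢q ∘ spoke-injective (side (proj₁ p-range) (proj₂ p-range)) (side (proj₁ q-range) (proj₂ q-range))

    rimColours↭colours : rimColours ↭ colours x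
    rimColours↭colours with zig-neighbour zig-prev | zig-neighbour zig-next
    ... | inj₁ p-lo | inj₁ q-lo = ⊥-elim (spoke[p]≢spoke[q] (trans p-lo (sym q-lo)))
    ... | inj₂ p-hi | inj₂ q-hi = ⊥-elim (spoke[p]≢spoke[q] (trans p-hi (sym q-hi)))
    ... | inj₁ p-lo | inj₂ q-hi = ↭-reflexive (cong₂ (λ y z → vertexCol x ∷ x ∷ edgeCol x y ∷ edgeCol x z ∷ []) p-lo q-hi)
    ... | inj₂ p-hi | inj₁ q-lo = ↭-trans (↭-reflexive (cong₂ (λ y z → vertexCol x ∷ x ∷ edgeCol x y ∷ edgeCol x z ∷ []) p-hi q-lo))
                                          (↭-prep (vertexCol x) (↭-prep x (↭-swap (edgeCol x (hi x)) (edgeCol x (lo x)) ↭-refl)))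

    x-block : Σ[ α ∈ ℕ ] 1 ≤ α × 3 + α ≤ t × colours x ↭ block α 3
    x-block with 2≤x , x≤1+m ← spoke-range (rim-side v) = local-block (level 2≤x x≤1+m)

    α : ℕ
    α = proj₁ x-block

    rimColours↭block : rimColours ↭ block α 3
    rimColours↭block = ↭-trans rimColours↭colours (proj₂ (proj₂ (proj₂ x-block)))

    colour⇔ : ∀ k → Colour (fsuc v) k ⇔ k ∈ rimColours
    colour⇔ k = mk⇔ to from
      where
      to : Colour (fsuc v) k → k ∈ rimColours
      to (inj₁ refl) = here refl
      to (inj₂ (w , vw , refl)) with incident w vw
      ... | inj₁ (_ , c≡x) = there (here c≡x)
      ... | inj₂ (inj₁ (_ , c≡edge)) = there (there (here c≡edge))
      ... | inj₂ (inj₂ (_ , c≡edge)) = there (there (there (here c≡edge)))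
      via-rim : ∀ {b} → 1 ≤ b × b ≤ m → b ≡ p ⊎ b ≡ q → k ≡ edgeCol x (spoke b) → Colour (fsuc v) k
      via-rim (1≤b , b≤m) b∈ k≡edge with w , refl ← rim-vertex 1≤b b≤m =
        inj₂ (fsuc w , rim-adjacent⇐ v (fsuc w) (inj₂ b∈) , sym k≡edge)
      from : k ∈ rimColours → Colour (fsuc v) k
      from (here k≡col) = inj₁ (sym k≡col)
      from (there (here k≡x)) = inj₂ (fzero , refl , sym k≡x)
      from (there (there (here k≡edge))) = via-rim p-range (inj₁ refl) k≡edge
      from (there (there (there (here k≡edge)))) = via-rim q-range (inj₂ refl) k≡edge

    3+α≡end : 3 + α ≡ α + degree adj (fsuc v)
    3+α≡end = trans (+-comm 3 α) (cong (α +_) (sym (degree-rim v)))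

    interval : ∀ k → Colour (fsuc v) k ⇔ (α ≤ k × k ≤ α + degree adj (fsuc v))
    interval k = mk⇔ (λ k∈ → let α≤k , k≤3+α = Equivalence.to in-block (Equivalence.to (colour⇔ k) k∈) in
                                α≤k , subst (k ≤_) 3+α≡end k≤3+α)
                     (λ (α≤k , k≤end) → Equivalence.from (colour⇔ k) (Equivalence.from in-block (α≤k , subst (k ≤_) (sym 3+α≡end) k≤end)))
      where
      in-block : k ∈ rimColours ⇔ (α ≤ k × k ≤ 3 + α)
      in-block = ↭-block-∈⇔ rimColours↭block

    incidence-proper : ∀ w → adj (fsuc v) w ≡ true → c (fsuc v) w ≢ f (fsuc v)
    incidence-proper w vw c≡col with ↭-block-unique rimColours↭block | incident w vw
    ... | (col≢x ∷ _ ∷ _ ∷ []) ∷ _ | inj₁ (_ , c≡x) = col≢x (trans (sym c≡col) c≡x)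
    ... | (_ ∷ col≢ep ∷ _ ∷ []) ∷ _ | inj₂ (inj₁ (_ , c≡ep)) = col≢ep (trans (sym c≡col) c≡ep)
    ... | (_ ∷ _ ∷ col≢eq ∷ []) ∷ _ | inj₂ (inj₂ (_ , c≡eq)) = col≢eq (trans (sym c≡col) c≡eq)

    edge-proper : ∀ w w′ → adj (fsuc v) w ≡ true → adj (fsuc v) w′ ≡ true → w ≢ w′ → c (fsuc v) w ≢ c (fsuc v) w′
    edge-proper w w′ vw vw′ w≢w′ c≡c′ with ↭-block-unique rimColours↭block
    ... | _ ∷ (x≢ep ∷ x≢eq ∷ []) ∷ (ep≢eq ∷ []) ∷ _ = distinct (incident w vw) (incident w′ vw′)
      where
      same : toℕ w ≡ toℕ w′ → ⊥
      same = w≢w′ ∘ toℕ-injective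
      distinct : Incident w → Incident w′ → ⊥
      distinct (inj₁ (b≡0 , _)) (inj₁ (b′≡0 , _)) = same (trans b≡0 (sym b′≡0))
      distinct (inj₁ (_ , c≡x)) (inj₂ (inj₁ (_ , c′≡ep))) = x≢ep (trans (sym c≡x) (trans c≡c′ c′≡ep))
      distinct (inj₁ (_ , c≡x)) (inj₂ (inj₂ (_ , c′≡eq))) = x≢eq (trans (sym c≡x) (trans c≡c′ c′≡eq))
      distinct (inj₂ (inj₁ (_ , c≡ep))) (inj₁ (_ , c′≡x)) = x≢ep (trans (sym c′≡x) (trans (sym c≡c′) c≡ep))
      distinct (inj₂ (inj₁ (b≡p , _))) (inj₂ (inj₁ (b′≡p , _))) = same (trans b≡p (sym b′≡p))
      distinct (inj₂ (inj₁ (_ , c≡ep))) (inj₂ (inj₂ (_ , c′≡eq))) = ep≢eq (trans (sym c≡ep) (trans c≡c′ c′≡eq))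
      distinct (inj₂ (inj₂ (_ , c≡eq))) (inj₁ (_ , c′≡x)) = x≢eq (trans (sym c′≡x) (trans (sym c≡c′) c≡eq))
      distinct (inj₂ (inj₂ (_ , c≡eq))) (inj₂ (inj₁ (_ , c′≡ep))) = ep≢eq (trans (sym c′≡ep) (trans (sym c≡c′) c≡eq))
      distinct (inj₂ (inj₂ (b≡q , _))) (inj₂ (inj₂ (b′≡q , _))) = same (trans b≡q (sym b′≡q))

  vertex-proper : ∀ v w → adj v w ≡ true → f v ≢ f w
  vertex-proper fzero fzero ()
  vertex-proper fzero (fsuc w) _ = <⇒≢ (2≤vertexCol (proj₂ (spoke-range (rim-side w))))
  vertex-proper (fsuc v) fzero _ = <⇒≢ (2≤vertexCol (proj₂ (spoke-range (rim-side v)))) ∘ sym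
  vertex-proper (fsuc v) (fsuc w) vw with rim-adjacent⇒ v (fsuc w) vw
  ... | inj₂ (inj₁ b≡p) = vertexCol-adjacent (subst (ZigAdjacent (AtRim.x v) ∘ spoke) (sym b≡p) (AtRim.zig-prev v))
  ... | inj₂ (inj₂ b≡q) = vertexCol-adjacent (subst (ZigAdjacent (AtRim.x v) ∘ spoke) (sym b≡q) (AtRim.zig-next v))

  edge-proper : ∀ v w w′ → adj v w ≡ true → adj v w′ ≡ true → w ≢ w′ → c v w ≢ c v w′
  edge-proper fzero (fsuc w) (fsuc w′) _ _ w≢w′ spoke≡spoke =
    w≢w′ (cong fsuc (toℕ-injective (suc-injective (spoke-injective (rim-side w) (rim-side w′) spoke≡spoke))))
  edge-proper (fsuc v) = AtRim.edge-proper v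

  incidence-proper : ∀ v w → adj v w ≡ true → c v w ≢ f v
  incidence-proper fzero (fsuc w) _ spoke≡1 = <⇒≢ (proj₁ (spoke-range (rim-side w))) (sym spoke≡1)
  incidence-proper (fsuc v) = AtRim.incidence-proper v

  start : Fin (suc m) → ℕ
  start fzero = 1
  start (fsuc v) = AtRim.α v

  interval : ∀ v k → Colour v k ⇔ (start v ≤ k × k ≤ start v + degree adj v)
  interval fzero k = subst (λ d → Colour fzero k ⇔ (1 ≤ k × k ≤ suc d)) (sym degree-hub) (hub-colour⇔ k)
  interval (fsuc v) = AtRim.interval v

  1≤start : ∀ v → 1 ≤ start v
  1≤start fzero = ≤-refl
  1≤start (fsuc v) = proj₁ (proj₂ (AtRim.x-block v))

  end≤t : ∀ v → start v + degree adj v ≤ t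
  end≤t fzero = subst (λ d → suc d ≤ t) (sym degree-hub) (≤-trans (n≤1+n (suc m)) 2+m≤t)
  end≤t (fsuc v) = subst (_≤ t) (AtRim.3+α≡end v) (proj₁ (proj₂ (proj₂ (AtRim.x-block v))))

  covered : ∀ k → 1 ≤ k → k ≤ t → ∃ λ v → Colour v k
  covered k 1≤k k≤t with k ≤? suc m
  ... | yes k≤1+m = fzero , Equivalence.from (hub-colour⇔ k) (1≤k , k≤1+m)
  ... | no k≰1+m with a , 1≤a , a≤m , spoke≡1+m ← spoke-surjective (s≤s (s≤s z≤n)) (≤-refl {suc m})
    with v , refl ← rim-vertex 1≤a a≤m =
      fsuc v , Equivalence.from (AtRim.colour⇔ v k)
                 (∈-resp-↭ (↭-sym (AtRim.rimColours↭colours v))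
                           (subst (λ x → k ∈ colours x) (sym spoke≡1+m) (∈-colours-apex (≰⇒> k≰1+m) k≤t)))

  colouring : IntervalTotalColoring adj t
  colouring = fromLocalIntervals adj f c start (λ v w _ → edgeColour-sym (toℕ v) (toℕ w))
    vertex-proper edge-proper incidence-proper interval 1≤start end≤t covered

lemma2 : ∀ (n : ℕ) → 5 ≤ n → InT (wheelAdj n) (n + 1) × InT (wheelAdj n) (n + 2)
lemma2 (suc (suc (suc (suc (suc μ))))) (s≤s (s≤s (s≤s (s≤s (s≤s _)))))
  with K , D , m≡K+D , D≤K , K≤1+D ← halves (4 + μ) =
  subst (InT (wheelAdj (5 + μ))) (+-comm 1 (5 + μ)) (WheelColouring.colouring μ K D m≡K+D D≤K K≤1+D below) ,
  subst (InT (wheelAdj (5 + μ))) (+-comm 2 (5 + μ)) (WheelColouring.colouring μ K D m≡K+D D≤K K≤1+D above)
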